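{- For all integers $n>1$ and $i\ge1$, and every primitive $n$-th root of unity $\omega_n$, $S_n(\omega_n^i)=S_{\gcd(s_n,i)}(1)$ and $G_n(\omega_n^i)=G_{\gcd(g_n,i)}(1)$.
   Context: For $n>1$, $s_n$ (resp. $g_n$) is the smallest (resp. greatest) prime factor of $n$. $\Phi_k(q)$ is the $k$-th cyclotomic polynomial. $S_1(q)=G_1(q)=\Phi_1(q)=q-1$, and for $n>1$, $S_n(q)=\Phi_{s_n}(q^{n/s_n})$, $G_n(q)=\Phi_{g_n}(q^{n/g_n})$. -}

module Defs where

open import Level using (Level)
open import Data.Nat as ℕ using (ℕ; zero; suc; _∸_; _≤?_; _<_)
open import Data.Nat.DivMod using (_/_)
open import Data.Nat.Divisibility using (_∣?_; _∣_)
open import Data.Nat.Primality using (Prime; prime?)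
open import Data.Integer as ℤ using (ℤ; +_; -[1+_])
open import Data.List using (List; []; _∷_; _++_; [_]; replicate; length; reverse; map; foldr; filter; upTo; head; last)
open import Data.Maybe using (Maybe; just; nothing; fromMaybe)
open import Data.Product using (_×_)
open import Relation.Nullary using (yes; no; ¬_)
open import Data.Sum using (_⊎_)
import Data.List
open import Relation.Nullary.Decidable using (_×-dec_)
open import Algebra.Bundles using (CommutativeRing)

primeFactors : ℕ → List ℕ
primeFactors n = filter (λ d → prime? d ×-dec d ∣? n) (upTo (suc n))

spf : ℕ → ℕ
spf n = fromMaybe 0 (head (primeFactors n))

gpf : ℕ → ℕ
gpf n = fromMaybe 0 (last (primeFactors n))

quot : ℕ → ℕ → ℕ
quot n zero    = 0
quot n (suc d) = n / suc d

-- Integer polynomials as coefficient lists (lowest degree first).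

Poly : Set
Poly = List ℤ

infixl 6 _⊕_
infixl 7 _⊗_

_⊕_ : Poly → Poly → Poly
[]      ⊕ q       = q
(a ∷ p) ⊕ []      = a ∷ p
(a ∷ p) ⊕ (b ∷ q) = (a ℤ.+ b) ∷ (p ⊕ q)

scale : ℤ → Poly → Poly
scale a = map (a ℤ.*_)

_⊗_ : Poly → Poly → Poly
[]      ⊗ q = []
(a ∷ p) ⊗ q = scale a q ⊕ (+ 0 ∷ (p ⊗ q))

neg : Poly → Poly
neg = map (λ a → ℤ.- a)

dropZeros : List ℤ → List ℤ
dropZeros []      = []
dropZeros (a ∷ p) with a ℤ.≟ + 0
... | yes _ = dropZeros p
... | no  _ = a ∷ p

strip : Poly → Poly
strip p = reverse (dropZeros (reverse p))

lead : Poly → ℤ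
lead p = fromMaybe (+ 0) (last p)

-- quotient of f by a monic g (both stripped), long division with fuel
divMonic : ℕ → Poly → Poly → Poly
divMonic zero    f g = []
divMonic (suc k) f g with length g ≤? length f
... | no  _ = []
... | yes _ = t ⊕ divMonic k (strip (f ⊕ neg (t ⊗ g))) g
  where t = replicate (length f ∸ length g) (+ 0) ++ [ lead f ]

xpowMinus1 : ℕ → Poly
xpowMinus1 k = strip ((-[1+ 0 ] ∷ []) ⊕ (replicate k (+ 0) ++ [ + 1 ]))

nth : List Poly → ℕ → Poly
nth []      _       = + 1 ∷ []
nth (p ∷ _) zero    = p
nth (_ ∷ l) (suc i) = nth l i

-- cycTable k = [Φ_1, ..., Φ_k], using  x^m - 1 = ∏_{d ∣ m} Φ_d(x)
cycTable : ℕ → List Poly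
cycTable zero    = []
cycTable (suc k) = T ++ [ strip (divMonic (suc (suc k)) (xpowMinus1 (suc k)) P) ]
  where
  T : List Poly
  T = cycTable k
  properDivs : List ℕ
  properDivs = filter (λ d → d ∣? suc k) (Data.List.drop 1 (upTo (suc k)))
  P : Poly
  P = strip (foldr (λ d acc → nth T (d ∸ 1) ⊗ acc) (+ 1 ∷ []) properDivs)

-- Φ_k, the k-th cyclotomic polynomial (k ≥ 1); Φ_0 = 1 is a junk value
Φ : ℕ → Poly
Φ k = nth (cycTable k) (k ∸ 1)

module _ {c ℓ : Level} (R : CommutativeRing c ℓ) where
  open CommutativeRing R

  natR : ℕ → Carrier
  natR zero    = 0#
  natR (suc n) = 1# + natR n

  intR : ℤ → Carrier
  intR (+ n)      = natR n
  intR -[1+ n ]   = - natR (suc n)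

  evalR : Poly → Carrier → Carrier
  evalR []      x = 0#
  evalR (a ∷ p) x = intR a + x * evalR p x

  powR : Carrier → ℕ → Carrier
  powR x zero    = 1#
  powR x (suc n) = x * powR x n

  IsPrimitiveRoot : ℕ → Carrier → Set ℓ
  IsPrimitiveRoot n ω = (powR ω n ≈ 1#) × (∀ k → 0 < k → k < n → ¬ (powR ω k ≈ 1#))

  IsIntegralDomain : Set (c Level.⊔ ℓ)
  IsIntegralDomain = ¬ (1# ≈ 0#) × (∀ x y → x * y ≈ 0# → (x ≈ 0#) ⊎ (y ≈ 0#))

  S : ℕ → Carrier → Carrier
  S (suc zero) q = q - 1#
  S n          q = evalR (Φ (spf n)) (powR q (quot n (spf n)))

  G : ℕ → Carrier → Carrier
  G (suc zero) q = q - 1#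
  G n          q = evalR (Φ (gpf n)) (powR q (quot n (gpf n)))

{-# OPTIONS --safe #-}
module Submission where

-- Let p be the chosen prime factor of n (s_n or g_n), n = m p and ζ = (ω^i)^m, so that the
-- left-hand side is Φ_p(ζ).  Then ζ^p = ω^(i n) = 1, and ζ = 1 exactly when n ∣ i m, i.e. p ∣ i.
-- As Φ_p = 1 + x + ⋯ + x^(p-1), if p ∣ i then Φ_p(ζ) = Φ_p(1) = p, the value at 1 of S_p and
-- G_p.  Otherwise (ζ - 1) Φ_p(ζ) = ζ^p - 1 = 0 with ζ ≠ 1, so Φ_p(ζ) = 0 = S_1(1) = G_1(1) in
-- an integral domain.  Only the primality of the chosen factor matters, so S and G are handled
-- by one argument.

open import Defs
open import Level using (Level)
open import Algebra.Bundles using (CommutativeRing)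
open import Data.Nat as ℕ using (ℕ; zero; suc; _<_; _≤_; _∸_; z≤n; s≤s; s<s; sz<ss; nonTrivial⇒n>1; NonZero)
import Data.Nat.Properties as ℕₚ
open import Data.Nat.Divisibility
  using (_∣_; _∣?_; divides; quotient; n/m≡quotient; n∣m*n; *-monoˡ-∣; *-cancelʳ-∣; m%n≡0⇒n∣m; ∣⇒≤
        ; ∣-refl; ∣-reflexive; ∣-trans; ∣-antisym)
open import Data.Nat.DivMod using (_/_; _%_; m≡m%n+[m/n]*n; m%n<n)
open import Data.Nat.GCD using (gcd; gcd[m,n]∣m; gcd[m,n]∣n; gcd-greatest)
open import Data.Nat.ListAction.Properties using (∈⇒∣product)
open import Data.Nat.Primality
  using (Prime; prime?; prime⇒irreducible; prime⇒nonTrivial; prime⇒nonZero; prime⇒¬composite; composite; ¬prime[1])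
open import Data.Nat.Primality.Factorisation using (factorise)
open import Data.Integer using (+_; -[1+_])
open import Data.List
  using (List; []; _∷_; _++_; [_]; _∷ʳ_; replicate; length; reverse; head; last; filter; drop; upTo; foldr)
open import Data.List.Properties using (reverse-++; reverse-involutive; length-++; filter-accept; filter-none)
open import Data.List.Membership.Propositional using (_∈_)
open import Data.List.Membership.Propositional.Properties using (∈-filter⁺; ∈-filter⁻; ∈-upTo⁺)
open import Data.List.Relation.Unary.Any using (here; there)
open import Data.List.Relation.Unary.All using (_∷_)
open import Data.List.Relation.Unary.All.Properties using (applyUpTo⁺₁)
open import Data.Maybe using (just; fromMaybe)
open import Data.Product using (_×_; _,_; proj₂; ∃-syntax)
open import Data.Sum using (inj₁; inj₂)
open import Relation.Nullary using (¬_; Dec; yes; no; contradiction)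
open import Function using (_∘_)
open import Relation.Nullary.Decidable using (_×-dec_)
import Relation.Binary.PropositionalEquality as ≡
open ≡ using (_≡_; refl; cong; cong₂; subst; module ≡-Reasoning)

last-∷ʳ : ∀ {A : Set} (xs : List A) x → last (xs ∷ʳ x) ≡ just x
last-∷ʳ []           x = refl
last-∷ʳ (_ ∷ [])     x = refl
last-∷ʳ (_ ∷ y ∷ xs) x = last-∷ʳ (y ∷ xs) x

fromMaybe-head-∈ : ∀ {A : Set} {xs : List A} {x} d → x ∈ xs → fromMaybe d (head xs) ∈ xs
fromMaybe-head-∈ {xs = _ ∷ _} d _ = here refl

fromMaybe-last-∈ : ∀ {A : Set} {xs : List A} {x} d → x ∈ xs → fromMaybe d (last xs) ∈ xs
fromMaybe-last-∈ {xs = _ ∷ []}    d _ = here refl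
fromMaybe-last-∈ {xs = _ ∷ y ∷ _} d _ = there (fromMaybe-last-∈ d (here {x = y} refl))

IsPrimeDivisor : ℕ → ℕ → Set
IsPrimeDivisor n p = Prime p × p ∣ n

∈-primeFactors⁻ : ∀ {n p} → p ∈ primeFactors n → IsPrimeDivisor n p
∈-primeFactors⁻ {n} p∈ = proj₂ (∈-filter⁻ (λ d → prime? d ×-dec d ∣? n) {xs = upTo (suc n)} p∈)

primeFactors-nonempty : ∀ {n} → 1 < n → ∃[ p ] p ∈ primeFactors n
primeFactors-nonempty {n} sz<ss with factorise n
... | record { factors = p ∷ ps ; isFactorisation = n≡Π ; factorsPrime = p-prime ∷ _ } =
  p , ∈-filter⁺ (λ d → prime? d ×-dec d ∣? n) (∈-upTo⁺ (s≤s (∣⇒≤ p∣n))) (p-prime , p∣n)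
  where
  p∣n : p ∣ n
  p∣n = subst (p ∣_) (≡.sym n≡Π) (∈⇒∣product {ns = p ∷ ps} (here refl))

ChoosesPrimeDivisor : (ℕ → ℕ) → Set
ChoosesPrimeDivisor F = ∀ {n} → 1 < n → IsPrimeDivisor n (F n)

spf-choosesPrimeDivisor : ChoosesPrimeDivisor spf
spf-choosesPrimeDivisor 1<n = ∈-primeFactors⁻ (fromMaybe-head-∈ 0 (proj₂ (primeFactors-nonempty 1<n)))

gpf-choosesPrimeDivisor : ChoosesPrimeDivisor gpf
gpf-choosesPrimeDivisor 1<n = ∈-primeFactors⁻ (fromMaybe-last-∈ 0 (proj₂ (primeFactors-nonempty 1<n)))

isPrimeDivisor-prime⇒≡ : ∀ {p q} → Prime p → IsPrimeDivisor p q → q ≡ p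
isPrimeDivisor-prime⇒≡ p-prime (q-prime , q∣p) with prime⇒irreducible p-prime q∣p
... | inj₁ refl = contradiction q-prime ¬prime[1]
... | inj₂ q≡p  = q≡p

choosesPrimeDivisor-prime : ∀ {F} → ChoosesPrimeDivisor F → ∀ {p} → Prime p → F p ≡ p
choosesPrimeDivisor-prime choice {p} p-prime =
  isPrimeDivisor-prime⇒≡ p-prime (choice (nonTrivial⇒n>1 p {{prime⇒nonTrivial p-prime}}))

m∣n⇒gcd[m,n]≡m : ∀ {m n} → m ∣ n → gcd m n ≡ m
m∣n⇒gcd[m,n]≡m {m} {n} m∣n = ∣-antisym (gcd[m,n]∣m m n) (gcd-greatest ∣-refl m∣n)

prime∤⇒gcd≡1 : ∀ {p n} → Prime p → ¬ p ∣ n → gcd p n ≡ 1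
prime∤⇒gcd≡1 {p} {n} p-prime p∤n with prime⇒irreducible p-prime (gcd[m,n]∣m p n)
... | inj₁ gcd≡1 = gcd≡1
... | inj₂ gcd≡p = contradiction (subst (_∣ n) gcd≡p (gcd[m,n]∣n p n)) p∤n

quot-∣ : ∀ {d n} (d∣n : d ∣ n) .{{_ : NonZero d}} → quot n d ≡ quotient d∣n
quot-∣ {suc _} d∣n = n/m≡quotient d∣n

Φ₁ : Poly
Φ₁ = -[1+ 0 ] ∷ + 1 ∷ []

monomial : ℕ → Poly
monomial k = replicate k (+ 0) ++ [ + 1 ]

ones : ℕ → Poly
ones m = replicate m (+ 1)

strip-∷ʳ-0 : ∀ p → strip (p ∷ʳ + 0) ≡ strip p
strip-∷ʳ-0 p = cong (λ q → reverse (dropZeros q)) (reverse-++ p [ + 0 ])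

strip-∷ʳ-1 : ∀ p → strip (p ∷ʳ + 1) ≡ p ∷ʳ + 1
strip-∷ʳ-1 p = begin
  reverse (dropZeros (reverse (p ∷ʳ + 1)))  ≡⟨ cong (λ q → reverse (dropZeros q)) (reverse-++ p [ + 1 ]) ⟩
  reverse (+ 1 ∷ reverse p)                 ≡⟨ reverse-++ [ + 1 ] (reverse p) ⟩
  reverse (reverse p) ∷ʳ + 1                ≡⟨ cong (_∷ʳ + 1) (reverse-involutive p) ⟩
  p ∷ʳ + 1                                  ∎
  where open ≡-Reasoning

length-monomial : ∀ k → length (monomial k) ≡ suc k
length-monomial zero    = refl
length-monomial (suc k) = cong suc (length-monomial k)

lead-monomial : ∀ k → lead (monomial k) ≡ + 1
lead-monomial k = cong (fromMaybe (+ 0)) (last-∷ʳ (replicate k (+ 0)) (+ 1))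

ones-∷ʳ : ∀ m → ones m ∷ʳ + 1 ≡ ones (suc m)
ones-∷ʳ zero    = refl
ones-∷ʳ (suc m) = cong (+ 1 ∷_) (ones-∷ʳ m)

strip-ones : ∀ m → strip (ones m) ≡ ones m
strip-ones zero    = refl
strip-ones (suc m) = begin
  strip (ones (suc m))   ≡⟨ cong strip (ones-∷ʳ m) ⟨
  strip (ones m ∷ʳ + 1)  ≡⟨ strip-∷ʳ-1 (ones m) ⟩
  ones m ∷ʳ + 1          ≡⟨ ones-∷ʳ m ⟩
  ones (suc m)           ∎
  where open ≡-Reasoning

monomial-⊕-ones : ∀ m → monomial m ⊕ ones m ≡ ones (suc m)
monomial-⊕-ones zero    = refl
monomial-⊕-ones (suc m) = cong (+ 1 ∷_) (monomial-⊕-ones m)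

monomial-⊗-Φ₁ : ∀ m → monomial m ⊗ Φ₁ ≡ replicate m (+ 0) ++ Φ₁
monomial-⊗-Φ₁ zero    = refl
monomial-⊗-Φ₁ (suc m) =
  ≡.trans (cong (λ p → (+ 0 ∷ + 0 ∷ []) ⊕ (+ 0 ∷ p)) (monomial-⊗-Φ₁ m)) (cong (+ 0 ∷_) (zero-⊕-shifted m))
  where
  zero-⊕-shifted : ∀ m → (+ 0 ∷ []) ⊕ (replicate m (+ 0) ++ Φ₁) ≡ replicate m (+ 0) ++ Φ₁
  zero-⊕-shifted zero    = refl
  zero-⊕-shifted (suc m) = refl

neg-shifted : ∀ m p → neg (replicate m (+ 0) ++ p) ≡ replicate m (+ 0) ++ neg p
neg-shifted zero    p = refl
neg-shifted (suc m) p = cong (+ 0 ∷_) (neg-shifted m p)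

xᵐ⁺¹-xᵐ[x-1] : ∀ m → (+ 0 ∷ monomial m) ⊕ (replicate m (+ 0) ++ neg Φ₁) ≡ monomial m ∷ʳ + 0
xᵐ⁺¹-xᵐ[x-1] zero    = refl
xᵐ⁺¹-xᵐ[x-1] (suc m) = cong (+ 0 ∷_) (xᵐ⁺¹-xᵐ[x-1] m)

leadingTerm : Poly → Poly → Poly
leadingTerm f g = replicate (length f ∸ length g) (+ 0) ++ [ lead f ]

divMonic-step : ∀ fuel f g → length g ≤ length f →
  divMonic (suc fuel) f g ≡ leadingTerm f g ⊕ divMonic fuel (strip (f ⊕ neg (leadingTerm f g ⊗ g))) g
divMonic-step fuel f g g≤f with length g ℕ.≤? length f
... | yes _   = refl
... | no  g≰f = contradiction g≤f g≰f

divMonic-[] : ∀ fuel a g → divMonic fuel [] (a ∷ g) ≡ []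
divMonic-[] zero    a g = refl
divMonic-[] (suc _) a g = refl

xpowMinus1-suc : ∀ m → xpowMinus1 (suc m) ≡ -[1+ 0 ] ∷ monomial m
xpowMinus1-suc m = strip-∷ʳ-1 (-[1+ 0 ] ∷ replicate m (+ 0))

leadingTerm-xpowMinus1 : ∀ m → leadingTerm (-[1+ 0 ] ∷ monomial (suc m)) Φ₁ ≡ monomial (suc m)
leadingTerm-xpowMinus1 m = cong₂ (λ k a → replicate k (+ 0) ++ [ a ]) (length-monomial m) (lead-monomial (suc m))

remainder-xpowMinus1 : ∀ m →
  strip ((-[1+ 0 ] ∷ monomial (suc m)) ⊕ neg (monomial (suc m) ⊗ Φ₁)) ≡ -[1+ 0 ] ∷ monomial m
remainder-xpowMinus1 m = begin
  strip ((-[1+ 0 ] ∷ monomial (suc m)) ⊕ neg (monomial (suc m) ⊗ Φ₁))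
    ≡⟨ cong (λ p → strip ((-[1+ 0 ] ∷ monomial (suc m)) ⊕ neg p)) (monomial-⊗-Φ₁ (suc m)) ⟩
  strip ((-[1+ 0 ] ∷ monomial (suc m)) ⊕ neg (replicate (suc m) (+ 0) ++ Φ₁))
    ≡⟨ cong (λ p → strip ((-[1+ 0 ] ∷ monomial (suc m)) ⊕ p)) (neg-shifted (suc m) Φ₁) ⟩
  strip (-[1+ 0 ] ∷ ((+ 0 ∷ monomial m) ⊕ (replicate m (+ 0) ++ neg Φ₁)))
    ≡⟨ cong (λ p → strip (-[1+ 0 ] ∷ p)) (xᵐ⁺¹-xᵐ[x-1] m) ⟩
  strip ((-[1+ 0 ] ∷ monomial m) ∷ʳ + 0)
    ≡⟨ strip-∷ʳ-0 (-[1+ 0 ] ∷ monomial m) ⟩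
  strip (-[1+ 0 ] ∷ monomial m)
    ≡⟨ strip-∷ʳ-1 (-[1+ 0 ] ∷ replicate m (+ 0)) ⟩
  -[1+ 0 ] ∷ monomial m
    ∎
  where open ≡-Reasoning

divMonic-xpowMinus1-Φ₁ : ∀ m fuel → m < fuel → divMonic fuel (-[1+ 0 ] ∷ monomial m) Φ₁ ≡ ones (suc m)
divMonic-xpowMinus1-Φ₁ zero    (suc fuel) _ = cong ([ + 1 ] ⊕_) (divMonic-[] fuel -[1+ 0 ] [ + 1 ])
divMonic-xpowMinus1-Φ₁ (suc m) (suc fuel) (s≤s m<fuel) = begin
  divMonic (suc fuel) f Φ₁
    ≡⟨ divMonic-step fuel f Φ₁ (s≤s (s≤s z≤n)) ⟩
  leadingTerm f Φ₁ ⊕ divMonic fuel (strip (f ⊕ neg (leadingTerm f Φ₁ ⊗ Φ₁))) Φ₁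
    ≡⟨ cong (λ t → t ⊕ divMonic fuel (strip (f ⊕ neg (t ⊗ Φ₁))) Φ₁) (leadingTerm-xpowMinus1 m) ⟩
  monomial (suc m) ⊕ divMonic fuel (strip (f ⊕ neg (monomial (suc m) ⊗ Φ₁))) Φ₁
    ≡⟨ cong (λ r → monomial (suc m) ⊕ divMonic fuel r Φ₁) (remainder-xpowMinus1 m) ⟩
  monomial (suc m) ⊕ divMonic fuel (-[1+ 0 ] ∷ monomial m) Φ₁
    ≡⟨ cong (monomial (suc m) ⊕_) (divMonic-xpowMinus1-Φ₁ m fuel m<fuel) ⟩
  monomial (suc m) ⊕ ones (suc m)
    ≡⟨ monomial-⊕-ones (suc m) ⟩
  ones (suc (suc m))
    ∎
  where
  open ≡-Reasoning
  f : Poly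
  f = -[1+ 0 ] ∷ monomial (suc m)

length-cycTable : ∀ k → length (cycTable k) ≡ k
length-cycTable zero    = refl
length-cycTable (suc k) =
  ≡.trans (length-++ (cycTable k)) (≡.trans (ℕₚ.+-comm (length (cycTable k)) 1) (cong suc (length-cycTable k)))

nth-∷ʳ : ∀ ps p {k} → length ps ≡ k → nth (ps ∷ʳ p) k ≡ p
nth-∷ʳ []       p refl = refl
nth-∷ʳ (_ ∷ ps) p refl = nth-∷ʳ ps p refl

nth-cycTable-0 : ∀ k → nth (cycTable (suc k)) 0 ≡ Φ₁
nth-cycTable-0 zero    = refl
nth-cycTable-0 (suc k) = nth-++-0 (cycTable (suc k)) (nth-cycTable-0 k)
  where
  nth-++-0 : ∀ ps {qs} → nth ps 0 ≡ Φ₁ → nth (ps ++ qs) 0 ≡ Φ₁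
  nth-++-0 (p ∷ ps) eq = eq

properDivisors-prime : ∀ {k} → Prime (suc (suc k)) →
  filter (_∣? suc (suc k)) (drop 1 (upTo (suc (suc k)))) ≡ [ 1 ]
properDivisors-prime {k} p-prime =
  ≡.trans (filter-accept (_∣? p) (divides p (≡.sym (ℕₚ.*-identityʳ p))))
          (cong (1 ∷_) (filter-none (_∣? p) (applyUpTo⁺₁ _ k d∤p)))
  where
  p : ℕ
  p = suc (suc k)
  d∤p : ∀ {i} → i < k → ¬ suc (suc i) ∣ p
  d∤p i<k d∣p = prime⇒¬composite p-prime (composite (s<s (s<s i<k)) d∣p)

Φ-prime : ∀ {p} → Prime p → Φ p ≡ ones p
Φ-prime {suc (suc k)} p-prime = begin
  Φ (suc (suc k))
    ≡⟨ nth-∷ʳ (cycTable (suc k)) _ (length-cycTable (suc k)) ⟩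
  [xᵖ-1]/∏Φ (filter (_∣? suc (suc k)) (drop 1 (upTo (suc (suc k)))))
    ≡⟨ cong [xᵖ-1]/∏Φ (properDivisors-prime p-prime) ⟩
  [xᵖ-1]/∏Φ [ 1 ]
    ≡⟨ cong (λ φ₁ → strip (divMonic (3 ℕ.+ k) (xpowMinus1 (2 ℕ.+ k)) (strip (φ₁ ⊗ [ + 1 ])))) (nth-cycTable-0 k) ⟩
  strip (divMonic (3 ℕ.+ k) (xpowMinus1 (2 ℕ.+ k)) Φ₁)
    ≡⟨ cong (λ f → strip (divMonic (3 ℕ.+ k) f Φ₁)) (xpowMinus1-suc (suc k)) ⟩
  strip (divMonic (3 ℕ.+ k) (-[1+ 0 ] ∷ monomial (suc k)) Φ₁)
    ≡⟨ cong strip (divMonic-xpowMinus1-Φ₁ (suc k) (3 ℕ.+ k) (ℕₚ.n≤1+n _)) ⟩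
  strip (ones (2 ℕ.+ k))
    ≡⟨ strip-ones (2 ℕ.+ k) ⟩
  ones (2 ℕ.+ k)
    ∎
  where
  open ≡-Reasoning
  [xᵖ-1]/∏Φ : List ℕ → Poly
  [xᵖ-1]/∏Φ ds = strip (divMonic (3 ℕ.+ k) (xpowMinus1 (2 ℕ.+ k))
                   (strip (foldr (λ d acc → nth (cycTable (suc k)) (d ∸ 1) ⊗ acc) (+ 1 ∷ []) ds)))

module _ {c ℓ : Level} (R : CommutativeRing c ℓ) where
  open CommutativeRing R renaming (refl to ≈-refl)
  open import Algebra.Properties.Ring ring using (x[y-z]≈xy-xz; x∙y⁻¹≈ε⇒x≈y)
  open import Algebra.Properties.Semiring.Exp semiring using (_^_; ^-congˡ; ^-homo-*; ^-assocʳ)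
  open import Relation.Binary.Reasoning.Setoid setoid

  powR≡^ : ∀ x n → powR R x n ≡ x ^ n
  powR≡^ x zero    = refl
  powR≡^ x (suc n) = cong (x *_) (powR≡^ x n)

  1^n≈1 : ∀ n → 1# ^ n ≈ 1#
  1^n≈1 zero    = ≈-refl
  1^n≈1 (suc n) = trans (*-identityˡ _) (1^n≈1 n)

  [a-b]+[c-a]≈c-b : ∀ a b c → (a - b) + (c - a) ≈ c - b
  [a-b]+[c-a]≈c-b a b c = begin
    (a - b) + (c - a)      ≈⟨ +-comm _ _ ⟩
    (c - a) + (a - b)      ≈⟨ +-assoc c (- a) (a - b) ⟩
    c + (- a + (a - b))    ≈⟨ +-congˡ (+-assoc (- a) a (- b)) ⟨
    c + ((- a + a) - b)    ≈⟨ +-congˡ (+-congʳ (-‿inverseˡ a)) ⟩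
    c + (0# - b)           ≈⟨ +-congˡ (+-identityˡ (- b)) ⟩
    c - b                  ∎

  evalR-cong : ∀ f {x y} → x ≈ y → evalR R f x ≈ evalR R f y
  evalR-cong []      x≈y = ≈-refl
  evalR-cong (a ∷ f) x≈y = +-congˡ (*-cong x≈y (evalR-cong f x≈y))

  evalR-ones-1 : ∀ m → evalR R (ones m) 1# ≈ natR R m
  evalR-ones-1 zero    = ≈-refl
  evalR-ones-1 (suc m) = +-cong (+-identityʳ 1#) (trans (*-identityˡ _) (evalR-ones-1 m))

  evalR-ones-geometric : ∀ m x → evalR R (ones m) x * (x - 1#) ≈ x ^ m - 1#
  evalR-ones-geometric zero    x = trans (zeroˡ _) (sym (-‿inverseʳ 1#))
  evalR-ones-geometric (suc m) x = begin
    ((1# + 0#) + x * E) * (x - 1#)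
      ≈⟨ distribʳ _ _ _ ⟩
    (1# + 0#) * (x - 1#) + x * E * (x - 1#)
      ≈⟨ +-cong (trans (*-congʳ (+-identityʳ 1#)) (*-identityˡ _)) (*-assoc _ _ _) ⟩
    (x - 1#) + x * (E * (x - 1#))
      ≈⟨ +-congˡ (*-congˡ (evalR-ones-geometric m x)) ⟩
    (x - 1#) + x * (x ^ m - 1#)
      ≈⟨ +-congˡ (x[y-z]≈xy-xz x (x ^ m) 1#) ⟩
    (x - 1#) + (x * x ^ m - x * 1#)
      ≈⟨ +-congˡ (+-congˡ (-‿cong (*-identityʳ x))) ⟩
    (x - 1#) + (x * x ^ m - x)
      ≈⟨ [a-b]+[c-a]≈c-b x 1# (x * x ^ m) ⟩
    x * x ^ m - 1#
      ∎
    where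
    E : Carrier
    E = evalR R (ones m) x

  ∣⇒^≈1 : ∀ {ω n k} → ω ^ n ≈ 1# → n ∣ k → ω ^ k ≈ 1#
  ∣⇒^≈1 {ω} {n} ωⁿ≈1 (divides j refl) = begin
    ω ^ (j ℕ.* n)   ≡⟨ cong (ω ^_) (ℕₚ.*-comm j n) ⟩
    ω ^ (n ℕ.* j)   ≈⟨ ^-assocʳ ω n j ⟨
    (ω ^ n) ^ j     ≈⟨ ^-congˡ j ωⁿ≈1 ⟩
    1# ^ j          ≈⟨ 1^n≈1 j ⟩
    1#              ∎

  primitiveRoot-^ : ∀ {n ω} → IsPrimitiveRoot R n ω → ω ^ n ≈ 1#
  primitiveRoot-^ {n} {ω} (ωⁿ≈1 , _) = trans (reflexive (≡.sym (powR≡^ ω n))) ωⁿ≈1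

  primitiveRoot-^≈1⇒∣ : ∀ {n ω k} .{{_ : NonZero n}} → IsPrimitiveRoot R n ω → ω ^ k ≈ 1# → n ∣ k
  primitiveRoot-^≈1⇒∣ {n} {ω} {k} prim@(_ , minimal) ωᵏ≈1 with n ∣? k
  ... | yes n∣k = n∣k
  ... | no  n∤k = contradiction (trans (reflexive (powR≡^ ω (k % n))) ω^[k%n]≈1)
                    (minimal (k % n) (ℕₚ.n≢0⇒n>0 (λ k%n≡0 → n∤k (m%n≡0⇒n∣m k n k%n≡0))) (m%n<n k n))
    where
    ω^[k%n]≈1 : ω ^ (k % n) ≈ 1#
    ω^[k%n]≈1 = begin
      ω ^ (k % n)                    ≈⟨ *-identityʳ _ ⟨
      ω ^ (k % n) * 1#               ≈⟨ *-congˡ (∣⇒^≈1 (primitiveRoot-^ prim) (n∣m*n (k / n))) ⟨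
      ω ^ (k % n) * ω ^ (k / n ℕ.* n) ≈⟨ ^-homo-* ω (k % n) (k / n ℕ.* n) ⟨
      ω ^ (k % n ℕ.+ k / n ℕ.* n)    ≡⟨ cong (ω ^_) (m≡m%n+[m/n]*n k n) ⟨
      ω ^ k                          ≈⟨ ωᵏ≈1 ⟩
      1#                             ∎

  Φ-prime-at-1 : ∀ {p} → Prime p → evalR R (Φ p) 1# ≈ natR R p
  Φ-prime-at-1 {p} p-prime = trans (reflexive (cong (λ f → evalR R f 1#) (Φ-prime p-prime))) (evalR-ones-1 p)

  Φ-prime-at-nontrivial-root : IsIntegralDomain R → ∀ {p ζ} → Prime p → ζ ^ p ≈ 1# → ¬ ζ ≈ 1# →
                               evalR R (Φ p) ζ ≈ 0#
  Φ-prime-at-nontrivial-root (_ , no-zero-divisors) {p} {ζ} p-prime ζᵖ≈1 ζ≉1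
    with no-zero-divisors (evalR R (ones p) ζ) (ζ - 1#) [1+ζ+⋯+ζᵖ⁻¹][ζ-1]≈0
    where
    [1+ζ+⋯+ζᵖ⁻¹][ζ-1]≈0 : evalR R (ones p) ζ * (ζ - 1#) ≈ 0#
    [1+ζ+⋯+ζᵖ⁻¹][ζ-1]≈0 = trans (evalR-ones-geometric p ζ) (trans (+-congʳ ζᵖ≈1) (-‿inverseʳ 1#))
  ... | inj₁ Φₚ[ζ]≈0 = trans (reflexive (cong (λ f → evalR R f ζ) (Φ-prime p-prime))) Φₚ[ζ]≈0
  ... | inj₂ ζ-1≈0   = contradiction (x∙y⁻¹≈ε⇒x≈y ζ 1# ζ-1≈0) ζ≉1

  module _ {n ω} (prim : IsPrimitiveRoot R n ω) {m p} (n≡m*p : n ≡ m ℕ.* p) (i : ℕ) where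

    private
      n≡p*m : n ≡ p ℕ.* m
      n≡p*m = ≡.trans n≡m*p (ℕₚ.*-comm m p)

      [ωⁱ]ᵐ≈ω^[i*m] : (ω ^ i) ^ m ≈ ω ^ (i ℕ.* m)
      [ωⁱ]ᵐ≈ω^[i*m] = ^-assocʳ ω i m

    [[ωⁱ]ᵐ]ᵖ≈1 : ((ω ^ i) ^ m) ^ p ≈ 1#
    [[ωⁱ]ᵐ]ᵖ≈1 = begin
      ((ω ^ i) ^ m) ^ p       ≈⟨ ^-congˡ p [ωⁱ]ᵐ≈ω^[i*m] ⟩
      (ω ^ (i ℕ.* m)) ^ p     ≈⟨ ^-assocʳ ω (i ℕ.* m) p ⟩
      ω ^ (i ℕ.* m ℕ.* p)     ≈⟨ ∣⇒^≈1 (primitiveRoot-^ prim) n∣i*m*p ⟩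
      1#                      ∎
      where
      n∣i*m*p : n ∣ i ℕ.* m ℕ.* p
      n∣i*m*p = subst (_∣ i ℕ.* m ℕ.* p) (≡.sym n≡m*p)
                  (∣-trans (n∣m*n i) (∣-reflexive (≡.sym (ℕₚ.*-assoc i m p))))

    ∣⇒[ωⁱ]ᵐ≈1 : p ∣ i → (ω ^ i) ^ m ≈ 1#
    ∣⇒[ωⁱ]ᵐ≈1 p∣i =
      trans [ωⁱ]ᵐ≈ω^[i*m] (∣⇒^≈1 (primitiveRoot-^ prim) (subst (_∣ i ℕ.* m) (≡.sym n≡p*m) (*-monoˡ-∣ m p∣i)))

    [ωⁱ]ᵐ≈1⇒∣ : .{{_ : NonZero n}} → (ω ^ i) ^ m ≈ 1# → p ∣ i
    [ωⁱ]ᵐ≈1⇒∣ {{n≢0}} ζ≈1 =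
      *-cancelʳ-∣ m {{m≢0}} (subst (_∣ i ℕ.* m) n≡p*m (primitiveRoot-^≈1⇒∣ prim (trans (sym [ωⁱ]ᵐ≈ω^[i*m]) ζ≈1)))
      where
      m≢0 : NonZero m
      m≢0 = ℕₚ.m*n≢0⇒m≢0 m {{subst NonZero n≡m*p n≢0}}

  cycloFactor : (ℕ → ℕ) → ℕ → Carrier → Carrier
  cycloFactor F 1 q = q - 1#
  cycloFactor F n q = evalR R (Φ (F n)) (powR R q (quot n (F n)))

  S≡cycloFactor-spf : ∀ n q → S R n q ≡ cycloFactor spf n q
  S≡cycloFactor-spf 0             q = refl
  S≡cycloFactor-spf 1             q = refl
  S≡cycloFactor-spf (suc (suc n)) q = refl

  G≡cycloFactor-gpf : ∀ n q → G R n q ≡ cycloFactor gpf n q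
  G≡cycloFactor-gpf 0             q = refl
  G≡cycloFactor-gpf 1             q = refl
  G≡cycloFactor-gpf (suc (suc n)) q = refl

  cycloFactor-unfold : ∀ F {n} q → 1 < n →
                       cycloFactor F n q ≡ evalR R (Φ (F n)) (powR R q (quot n (F n)))
  cycloFactor-unfold F q sz<ss = refl

  cycloFactor-prime-at-1 : ∀ {F} → ChoosesPrimeDivisor F → ∀ {p} → Prime p → cycloFactor F p 1# ≈ natR R p
  cycloFactor-prime-at-1 {F} choice {p} p-prime = begin
    cycloFactor F p 1#
      ≡⟨ cycloFactor-unfold F 1# 1<p ⟩
    evalR R (Φ (F p)) (powR R 1# (quot p (F p)))
      ≡⟨ cong (λ d → evalR R (Φ d) (powR R 1# (quot p d))) (choosesPrimeDivisor-prime choice p-prime) ⟩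
    evalR R (Φ p) (powR R 1# (quot p p))
      ≈⟨ evalR-cong (Φ p) (trans (reflexive (powR≡^ 1# (quot p p))) (1^n≈1 (quot p p))) ⟩
    evalR R (Φ p) 1#
      ≈⟨ Φ-prime-at-1 p-prime ⟩
    natR R p
      ∎
    where
    1<p : 1 < p
    1<p = nonTrivial⇒n>1 p {{prime⇒nonTrivial p-prime}}

  cycloFactor-1 : ∀ F → cycloFactor F 1 1# ≈ 0#
  cycloFactor-1 F = -‿inverseʳ 1#

  cycloFactor-primitiveRoot : IsIntegralDomain R → ∀ {F} → ChoosesPrimeDivisor F →
    ∀ {n ω} → 1 < n → IsPrimitiveRoot R n ω → ∀ i →
    cycloFactor F n (powR R ω i) ≈ cycloFactor F (gcd (F n) i) 1#
  cycloFactor-primitiveRoot dom {F} choice {n} {ω} 1<n@sz<ss prim i with choice 1<n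
  ... | p-prime , p∣n@(divides m n≡m*p) = case-∣ (F n ∣? i)
    where
    p : ℕ
    p = F n
    instance
      p≢0 : NonZero p
      p≢0 = prime⇒nonZero p-prime
    ζ : Carrier
    ζ = (ω ^ i) ^ m
    cycloFactor≡Φₚ[ζ] : cycloFactor F n (powR R ω i) ≡ evalR R (Φ p) ζ
    cycloFactor≡Φₚ[ζ] = ≡.trans (cycloFactor-unfold F (powR R ω i) 1<n)
      (cong (evalR R (Φ p)) (≡.trans (cong (powR R (powR R ω i)) (quot-∣ p∣n))
        (≡.trans (powR≡^ (powR R ω i) m) (cong (_^ m) (powR≡^ ω i)))))
    case-∣ : Dec (p ∣ i) → cycloFactor F n (powR R ω i) ≈ cycloFactor F (gcd p i) 1#
    case-∣ (yes p∣i) = begin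
      cycloFactor F n (powR R ω i)  ≡⟨ cycloFactor≡Φₚ[ζ] ⟩
      evalR R (Φ p) ζ               ≈⟨ evalR-cong (Φ p) (∣⇒[ωⁱ]ᵐ≈1 prim {m} n≡m*p i p∣i) ⟩
      evalR R (Φ p) 1#              ≈⟨ Φ-prime-at-1 p-prime ⟩
      natR R p                      ≈⟨ cycloFactor-prime-at-1 choice p-prime ⟨
      cycloFactor F p 1#            ≡⟨ cong (λ d → cycloFactor F d 1#) (m∣n⇒gcd[m,n]≡m p∣i) ⟨
      cycloFactor F (gcd p i) 1#    ∎
    case-∣ (no p∤i) = begin
      cycloFactor F n (powR R ω i)  ≡⟨ cycloFactor≡Φₚ[ζ] ⟩
      evalR R (Φ p) ζ               ≈⟨ Φ-prime-at-nontrivial-root dom p-prime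
                                         ([[ωⁱ]ᵐ]ᵖ≈1 prim {m} n≡m*p i) (p∤i ∘ [ωⁱ]ᵐ≈1⇒∣ prim {m} n≡m*p i) ⟩
      0#                            ≈⟨ cycloFactor-1 F ⟨
      cycloFactor F 1 1#            ≡⟨ cong (λ d → cycloFactor F d 1#) (prime∤⇒gcd≡1 p-prime p∤i) ⟨
      cycloFactor F (gcd p i) 1#    ∎

theorem12 : {c ℓ : Level} (R : CommutativeRing c ℓ) → IsIntegralDomain R →
            (n i : ℕ) → 1 < n → 1 ≤ i →
            (ω : CommutativeRing.Carrier R) → IsPrimitiveRoot R n ω →
            (CommutativeRing._≈_ R (S R n (powR R ω i)) (S R (gcd (spf n) i) (CommutativeRing.1# R)))
            × (CommutativeRing._≈_ R (G R n (powR R ω i)) (G R (gcd (gpf n) i) (CommutativeRing.1# R)))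
theorem12 R dom n i 1<n _ ω prim =
    ≡.subst₂ _≈_ (≡.sym (S≡cycloFactor-spf R n _)) (≡.sym (S≡cycloFactor-spf R (gcd (spf n) i) 1#))
      (cycloFactor-primitiveRoot R dom spf-choosesPrimeDivisor 1<n prim i)
  , ≡.subst₂ _≈_ (≡.sym (G≡cycloFactor-gpf R n _)) (≡.sym (G≡cycloFactor-gpf R (gcd (gpf n) i) 1#))
      (cycloFactor-primitiveRoot R dom gpf-choosesPrimeDivisor 1<n prim i)
  where open CommutativeRing R using (_≈_; 1#)
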